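{- Let $\mathcal{C}^-$ be the labelled calculus with the rules $(\wedge_l),(\wedge_r),(\vee_l),(\vee_r),(\supset_r),(id^*),(\neg_l),(\neg_r),(\supset^*_l),(lift)$ (i.e. $\mathsf{G3Int}+\{(id^*),(\neg_l),(\neg_r),(\supset^*_l),(lift)\}-\{(id),(\bot_l),(\supset_l),(ref),(tra)\}$). Every derivation in $\mathcal{C}^-$ whose end sequent is $\Rightarrow w:A$ contains only treelike labelled sequents, and $w$ is the root of each sequent in the derivation.
   Context: Formulas are built from propositional variables $p$ and $\bot$ using $\wedge,\vee,\supset,\neg$. Labelled sequents $\mathcal{R},\Gamma\Rightarrow\Delta$: $\mathcal{R}$ a multiset of relational atoms $w\le v$ ($w,v$ labels), $\Gamma,\Delta$ multisets of labelled formulas $w:A$; components may be empty. Rules: $(\wedge_l)$: from $\mathcal{R},w:A,w:B,\Gamma\Rightarrow\Delta$ infer $\mathcal{R},w:A\wedge B,\Gamma\Rightarrow\Delta$; $(\wedge_r)$: from $\mathcal{R},\Gamma\Rightarrow\Delta,w:A$ and $\mathcal{R},\Gamma\Rightarrow\Delta,w:B$ infer $\mathcal{R},\Gamma\Rightarrow\Delta,w:A\wedge B$; $(\vee_l)$: from $\mathcal{R},w:A,\Gamma\Rightarrow\Delta$ and $\mathcal{R},w:B,\Gamma\Rightarrow\Delta$ infer $\mathcal{R},w:A\vee B,\Gamma\Rightarrow\Delta$; $(\vee_r)$: from $\mathcal{R},\Gamma\Rightarrow\Delta,w:A,w:B$ infer $\mathcal{R},\Gamma\Rightarrow\Delta,w:A\vee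 B$; $(\supset_r)$: from $\mathcal{R},w\le v,v:A,\Gamma\Rightarrow\Delta,v:B$ infer $\mathcal{R},\Gamma\Rightarrow\Delta,w:A\supset B$, $v$ not in the conclusion; $(id^*)$: $\mathcal{R},w:p,\Gamma\Rightarrow\Delta,w:p$ (axiom); $(\neg_r)$: from $\mathcal{R},w\le v,v:A,\Gamma\Rightarrow\Delta$ infer $\mathcal{R},\Gamma\Rightarrow\Delta,w:\neg A$, $v$ not in the conclusion; $(\neg_l)$: from $\mathcal{R},w:\neg A,\Gamma\Rightarrow\Delta,w:A$ infer $\mathcal{R},w:\neg A,\Gamma\Rightarrow\Delta$; $(\supset^*_l)$: from $\mathcal{R},w:A\supset B,\Gamma\Rightarrow\Delta,w:A$ and $\mathcal{R},w:A\supset B,w:B,\Gamma\Rightarrow\Delta$ infer $\mathcal{R},w:A\supset B,\Gamma\Rightarrow\Delta$; $(lift)$: from $\mathcal{R},w\le u,w:A,u:A,\Gamma\Rightarrow\Delta$ infer $\mathcal{R},w\le u,w:A,\Gamma\Rightarrow\Delta$. The graph of a labelled sequent $\Lambda$ has as vertices the labels occurring in $\Lambda$ and a directed edge $(w,v)$ iff $w\le v$ occurs in $\Lambda$. $\Lambda$ is treelike iff there is a unique vertex $w$, the root, such that for every other vertex $v$ there is a unique directed path from $w$ to $v$. -}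

module Defs where

open import Data.Nat using (ℕ)
open import Data.Product using (Σ; _×_; _,_)
open import Data.List using (List; []; _∷_; concatMap; _++_)
open import Data.List.Membership.Propositional using (_∈_; _∉_)
open import Data.List.Relation.Binary.Permutation.Propositional using (_↭_)
open import Data.List.Relation.Unary.Unique.Propositional using (Unique)
open import Relation.Binary.PropositionalEquality using (_≡_; _≢_)

data Fm : Set where
  var  : ℕ → Fm
  ⊥ᶠ   : Fm
  _∧ᶠ_ : Fm → Fm → Fm
  _∨ᶠ_ : Fm → Fm → Fm
  _⊃ᶠ_ : Fm → Fm → Fm
  ¬ᶠ_  : Fm → Fm

Label : Set
Label = ℕ

LFm : Set
LFm = Label × Fm

-- relational atom w ≤ v, represented as the pair (w , v)
RelAtom : Set
RelAtom = Label × Label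

-- labelled sequent  R , Γ ⇒ Δ  (multisets represented by lists, up to permutation)
record Seq : Set where
  constructor ⟨_,_⇒_⟩
  field
    rel : List RelAtom
    ant : List LFm
    suc : List LFm
open Seq public

record _≈ₛ_ (S T : Seq) : Set where
  field
    rel≈ : rel S ↭ rel T
    ant≈ : ant S ↭ ant T
    suc≈ : suc S ↭ suc T

labels : Seq → List Label
labels S = concatMap (λ { (w , v) → w ∷ v ∷ [] }) (rel S)
        ++ concatMap (λ { (w , A) → w ∷ [] }) (ant S)
        ++ concatMap (λ { (w , A) → w ∷ [] }) (suc S)

data Deriv : Seq → Set where
  ∧l   : ∀ {S R Γ Δ w A B} → S ≈ₛ ⟨ R , (w , A ∧ᶠ B) ∷ Γ ⇒ Δ ⟩ →
         Deriv ⟨ R , (w , A) ∷ (w , B) ∷ Γ ⇒ Δ ⟩ → Deriv S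
  ∧r   : ∀ {S R Γ Δ w A B} → S ≈ₛ ⟨ R , Γ ⇒ (w , A ∧ᶠ B) ∷ Δ ⟩ →
         Deriv ⟨ R , Γ ⇒ (w , A) ∷ Δ ⟩ → Deriv ⟨ R , Γ ⇒ (w , B) ∷ Δ ⟩ → Deriv S
  ∨l   : ∀ {S R Γ Δ w A B} → S ≈ₛ ⟨ R , (w , A ∨ᶠ B) ∷ Γ ⇒ Δ ⟩ →
         Deriv ⟨ R , (w , A) ∷ Γ ⇒ Δ ⟩ → Deriv ⟨ R , (w , B) ∷ Γ ⇒ Δ ⟩ → Deriv S
  ∨r   : ∀ {S R Γ Δ w A B} → S ≈ₛ ⟨ R , Γ ⇒ (w , A ∨ᶠ B) ∷ Δ ⟩ →
         Deriv ⟨ R , Γ ⇒ (w , A) ∷ (w , B) ∷ Δ ⟩ → Deriv S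
  ⊃r   : ∀ {S R Γ Δ w v A B} → S ≈ₛ ⟨ R , Γ ⇒ (w , A ⊃ᶠ B) ∷ Δ ⟩ →
         v ∉ labels ⟨ R , Γ ⇒ (w , A ⊃ᶠ B) ∷ Δ ⟩ →
         Deriv ⟨ (w , v) ∷ R , (v , A) ∷ Γ ⇒ (v , B) ∷ Δ ⟩ → Deriv S
  id*  : ∀ {S R Γ Δ w p} → S ≈ₛ ⟨ R , (w , var p) ∷ Γ ⇒ (w , var p) ∷ Δ ⟩ → Deriv S
  ¬r   : ∀ {S R Γ Δ w v A} → S ≈ₛ ⟨ R , Γ ⇒ (w , ¬ᶠ A) ∷ Δ ⟩ →
         v ∉ labels ⟨ R , Γ ⇒ (w , ¬ᶠ A) ∷ Δ ⟩ →
         Deriv ⟨ (w , v) ∷ R , (v , A) ∷ Γ ⇒ Δ ⟩ → Deriv S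
  ¬l   : ∀ {S R Γ Δ w A} → S ≈ₛ ⟨ R , (w , ¬ᶠ A) ∷ Γ ⇒ Δ ⟩ →
         Deriv ⟨ R , (w , ¬ᶠ A) ∷ Γ ⇒ (w , A) ∷ Δ ⟩ → Deriv S
  ⊃*l  : ∀ {S R Γ Δ w A B} → S ≈ₛ ⟨ R , (w , A ⊃ᶠ B) ∷ Γ ⇒ Δ ⟩ →
         Deriv ⟨ R , (w , A ⊃ᶠ B) ∷ Γ ⇒ (w , A) ∷ Δ ⟩ →
         Deriv ⟨ R , (w , A ⊃ᶠ B) ∷ (w , B) ∷ Γ ⇒ Δ ⟩ → Deriv S
  lift : ∀ {S R Γ Δ w u A} → S ≈ₛ ⟨ (w , u) ∷ R , (w , A) ∷ Γ ⇒ Δ ⟩ →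
         Deriv ⟨ (w , u) ∷ R , (w , A) ∷ (u , A) ∷ Γ ⇒ Δ ⟩ → Deriv S

Everywhere : (P : Seq → Set) → ∀ {S} → Deriv S → Set
Everywhere P {S} (∧l _ d)      = P S × Everywhere P d
Everywhere P {S} (∧r _ d e)    = P S × Everywhere P d × Everywhere P e
Everywhere P {S} (∨l _ d e)    = P S × Everywhere P d × Everywhere P e
Everywhere P {S} (∨r _ d)      = P S × Everywhere P d
Everywhere P {S} (⊃r _ _ d)    = P S × Everywhere P d
Everywhere P {S} (id* _)       = P S
Everywhere P {S} (¬r _ _ d)    = P S × Everywhere P d
Everywhere P {S} (¬l _ d)      = P S × Everywhere P d
Everywhere P {S} (⊃*l _ d e)   = P S × Everywhere P d × Everywhere P e
Everywhere P {S} (lift _ d)    = P S × Everywhere P d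

-- Graph of a sequent: vertices = labels S, edge (w , v) iff (w , v) ∈ rel S.
-- Walk S a b vs : vs is the vertex sequence of a directed walk from a to b
data Walk (S : Seq) : Label → Label → List Label → Set where
  here : ∀ {a} → Walk S a a (a ∷ [])
  step : ∀ {a b c vs} → (a , b) ∈ rel S → Walk S b c vs → Walk S a c (a ∷ vs)

Path : Seq → Label → Label → List Label → Set
Path S a b vs = Walk S a b vs × Unique vs

UniquePath : Seq → Label → Label → Set
UniquePath S a b = Σ (List Label) λ p → Path S a b p × (∀ q → Path S a b q → q ≡ p)

IsRoot : Seq → Label → Set
IsRoot S r = r ∈ labels S × (∀ v → v ∈ labels S → v ≢ r → UniquePath S r v)

Treelike : Seq → Set
Treelike S = Σ Label λ r → IsRoot S r × (∀ r′ → IsRoot S r′ → r′ ≡ r)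

-- Read bottom-up, every rule of C⁻ either keeps the relational atoms and the set of labels
-- of its conclusion, or, for (⊃r) and (¬r), adds one atom w ≤ v from an old label w to a
-- fresh label v. Starting from ⇒ w:A, the relational atoms of every sequent therefore form
-- a tree grown from w by attaching fresh leaves, and every label is a vertex of it. In such
-- a tree each vertex is reached from w by exactly one walk, and no walk enters w, so w is
-- the one and only root. The rules (ref) and (tra), which would add non-tree edges, are
-- exactly the ones missing from C⁻.
module Submission where

open import Defs
open import Data.Empty using (⊥-elim)
open import Data.Nat using (_≟_)
open import Data.Product using (∃; _×_; _,_; proj₁; map₁; map₂)
open import Data.Sum using (_⊎_; inj₁; inj₂)
open import Data.List using (List; []; _∷_; _++_; [_]; concatMap)
open import Data.List.Membership.Propositional using (_∈_; _∉_)
open import Data.List.Relation.Unary.Any using (here; there)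
open import Data.List.Relation.Unary.All as All using (All; []; _∷_)
open import Data.List.Relation.Unary.AllPairs using ([]; _∷_)
import Data.List.Relation.Unary.AllPairs.Properties as AllPairs
open import Data.List.Relation.Binary.Subset.Propositional using (_⊆_)
open import Data.List.Relation.Binary.Permutation.Propositional
  using (_↭_; ↭-sym; ↭-trans; ↭-prep; ↭-swap; ↭-refl)
open import Data.List.Relation.Binary.Permutation.Propositional.Properties
  using (shift; ++⁺ˡ; ∈-resp-↭)
open import Data.List.Relation.Binary.BagAndSetEquality
  using (_∼[_]_; set; bag; [_]-Equality; bag-=⇒; ↭⇒∼bag; ∷-cong; ++-cong; concat-cong; map-cong)
open import Function using (_∘_)
open import Function.Bundles using (Equivalence; mk⇔)
open import Relation.Nullary using (¬_; yes; no)
open import Relation.Binary.Bundles using (Setoid)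
import Relation.Binary.Reasoning.Setoid as SetoidReasoning
open import Relation.Binary.PropositionalEquality using (_≡_; _≢_; refl; sym; cong)

module SetEq {A : Set} = Setoid ([ set ]-Equality A)

IsVertex : Label → List RelAtom → Label → Set
IsVertex r E x = x ≡ r ⊎ ∃ λ y → (y , x) ∈ E

data Tree (r : Label) : List RelAtom → Set where
  root : Tree r []
  grow : ∀ {E x v} → Tree r E → IsVertex r E x → ¬ IsVertex r E v → Tree r ((x , v) ∷ E)

graph : List RelAtom → Seq
graph E = ⟨ E , [] ⇒ [] ⟩

IsVertex-there : ∀ {r E e x} → IsVertex r E x → IsVertex r (e ∷ E) x
IsVertex-there (inj₁ x≡r) = inj₁ x≡r
IsVertex-there (inj₂ (y , e)) = inj₂ (y , there e)

Tree-source : ∀ {r E a b} → Tree r E → (a , b) ∈ E → IsVertex r E a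
Tree-source (grow _ x∈ _) (here refl) = IsVertex-there x∈
Tree-source (grow tree _ _) (there e) = IsVertex-there (Tree-source tree e)

Tree-root-no-parent : ∀ {r E y} → Tree r E → (y , r) ∉ E
Tree-root-no-parent (grow _ _ v∉) (here refl) = v∉ (inj₁ refl)
Tree-root-no-parent (grow tree _ _) (there e) = Tree-root-no-parent tree e

Walk-mono : ∀ {S T a b vs} → rel S ⊆ rel T → Walk S a b vs → Walk T a b vs
Walk-mono S⊆T here = here
Walk-mono S⊆T (step e walk) = step (S⊆T e) (Walk-mono S⊆T walk)

Walk-snoc : ∀ {S a b c vs} → Walk S a b vs → (b , c) ∈ rel S → Walk S a c (vs ++ [ c ])
Walk-snoc here e = step e here
Walk-snoc (step e′ walk) e = step e′ (Walk-snoc walk e)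

Walk-vertices : ∀ {r E a b vs} → IsVertex r E a → Walk (graph E) a b vs → All (IsVertex r E) vs
Walk-vertices a∈ here = a∈ ∷ []
Walk-vertices a∈ (step e walk) = a∈ ∷ Walk-vertices (inj₂ (_ , e)) walk

Walk-into-root : ∀ {r E a vs} → Tree r E → Walk (graph E) a r vs → a ≡ r
Walk-into-root tree here = refl
Walk-into-root tree (step e walk) with refl ← Walk-into-root tree walk =
  ⊥-elim (Tree-root-no-parent tree e)

module Leaf {r E x v} (tree : Tree r E) (x∈ : IsVertex r E x) (v∉ : ¬ IsVertex r E v) where

  E′ : List RelAtom
  E′ = (x , v) ∷ E

  root≢leaf : r ≢ v
  root≢leaf refl = v∉ (inj₁ refl)

  leaf-no-child : ∀ {b} → (v , b) ∉ E′
  leaf-no-child (here refl) = v∉ x∈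
  leaf-no-child (there e) = v∉ (Tree-source tree e)

  walk-avoiding-leaf : ∀ {a t vs} → t ≢ v → Walk (graph E′) a t vs → Walk (graph E) a t vs
  walk-avoiding-leaf t≢v here = here
  walk-avoiding-leaf t≢v (step (here refl) here) = ⊥-elim (t≢v refl)
  walk-avoiding-leaf t≢v (step (here refl) (step e _)) = ⊥-elim (leaf-no-child e)
  walk-avoiding-leaf t≢v (step (there e) walk) = step e (walk-avoiding-leaf t≢v walk)

  walk-into-leaf : ∀ {a vs} → a ≢ v → Walk (graph E′) a v vs →
                   ∃ λ ps → vs ≡ ps ++ [ v ] × Walk (graph E) a x ps
  walk-into-leaf a≢v here = ⊥-elim (a≢v refl)
  walk-into-leaf a≢v (step (here refl) here) = _ , refl , here
  walk-into-leaf a≢v (step (here refl) (step e _)) = ⊥-elim (leaf-no-child e)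
  walk-into-leaf a≢v (step {b = b} (there e) walk) with b ≟ v
  ... | yes refl = ⊥-elim (v∉ (inj₂ (_ , e)))
  ... | no b≢v =
    let ps , vs≡ , walk′ = walk-into-leaf b≢v walk
    in _ ∷ ps , cong (_ ∷_) vs≡ , step e walk′

  path-to-leaf : ∀ {ps} → Path (graph E) r x ps → Path (graph E′) r v (ps ++ [ v ])
  path-to-leaf (walk , unique) =
    Walk-snoc (Walk-mono there walk) (here refl) ,
    AllPairs.++⁺ unique ([] ∷ [])
      (All.map (λ y∈ → (λ { refl → v∉ y∈ }) ∷ []) (Walk-vertices (inj₁ refl) walk))

  walks-unique : (∀ {t vs vs′} → Walk (graph E) r t vs → Walk (graph E) r t vs′ → vs ≡ vs′) →
                 ∀ {t vs vs′} → Walk (graph E′) r t vs → Walk (graph E′) r t vs′ → vs ≡ vs′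
  walks-unique unique {t} walk walk′ with t ≟ v
  ... | no t≢v = unique (walk-avoiding-leaf t≢v walk) (walk-avoiding-leaf t≢v walk′)
  ... | yes refl
    with _ , refl , p ← walk-into-leaf root≢leaf walk
       | _ , refl , p′ ← walk-into-leaf root≢leaf walk′
    = cong (_++ [ v ]) (unique p p′)

Tree-path : ∀ {r E t} → Tree r E → IsVertex r E t → ∃ λ vs → Path (graph E) r t vs
Tree-path root (inj₁ refl) = _ , here , [] ∷ []
Tree-path (grow tree x∈ v∉) (inj₂ (_ , here refl)) =
  let _ , path = Tree-path tree x∈ in _ , Leaf.path-to-leaf tree x∈ v∉ path
Tree-path (grow tree _ _) (inj₁ refl) =
  map₂ (map₁ (Walk-mono there)) (Tree-path tree (inj₁ refl))
Tree-path (grow tree _ _) (inj₂ (y , there e)) =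
  map₂ (map₁ (Walk-mono there)) (Tree-path tree (inj₂ (y , e)))

Tree-walk-unique : ∀ {r E t vs vs′} → Tree r E →
                   Walk (graph E) r t vs → Walk (graph E) r t vs′ → vs ≡ vs′
Tree-walk-unique root here here = refl
Tree-walk-unique root here (step () _)
Tree-walk-unique root (step () _) _
Tree-walk-unique (grow tree x∈ v∉) = Leaf.walks-unique tree x∈ v∉ (Tree-walk-unique tree)

concatMap-cong : ∀ {A : Set} {f : A → List Label} {xs ys} → xs ↭ ys →
                 concatMap f xs ∼[ bag ] concatMap f ys
concatMap-cong xs↭ys = concat-cong (map-cong (λ _ → refl) (↭⇒∼bag xs↭ys))

labels-resp-≈ₛ : ∀ {S T} → S ≈ₛ T → labels S ∼[ set ] labels T
labels-resp-≈ₛ S≈T =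
  bag-=⇒ (++-cong (concatMap-cong rel≈) (++-cong (concatMap-cong ant≈) (concatMap-cong suc≈)))
  where open _≈ₛ_ S≈T

↭⇒∼set : ∀ {A : Set} {xs ys : List A} → xs ↭ ys → xs ∼[ set ] ys
↭⇒∼set xs↭ys = bag-=⇒ (↭⇒∼bag xs↭ys)

∷-absorb : ∀ {A : Set} {x : A} {xs} → x ∈ xs → x ∷ xs ∼[ set ] xs
∷-absorb x∈xs = mk⇔ (λ { (here refl) → x∈xs ; (there y∈xs) → y∈xs }) there

labels-ant : ∀ R Γ Δ (f : LFm) → labels ⟨ R , f ∷ Γ ⇒ Δ ⟩ ↭ proj₁ f ∷ labels ⟨ R , Γ ⇒ Δ ⟩
labels-ant R Γ Δ f = shift (proj₁ f) (concatMap _ R) _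

labels-suc : ∀ R Γ Δ (f : LFm) → labels ⟨ R , Γ ⇒ f ∷ Δ ⟩ ↭ proj₁ f ∷ labels ⟨ R , Γ ⇒ Δ ⟩
labels-suc R Γ Δ f = ↭-trans (++⁺ˡ (concatMap _ R) (shift (proj₁ f) (concatMap _ Γ) _))
                             (shift (proj₁ f) (concatMap _ R) _)

∈-labels-ant : ∀ R Γ Δ (f : LFm) → proj₁ f ∈ labels ⟨ R , f ∷ Γ ⇒ Δ ⟩
∈-labels-ant R Γ Δ f = ∈-resp-↭ (↭-sym (labels-ant R Γ Δ f)) (here refl)

∈-labels-suc : ∀ R Γ Δ (f : LFm) → proj₁ f ∈ labels ⟨ R , Γ ⇒ f ∷ Δ ⟩
∈-labels-suc R Γ Δ f = ∈-resp-↭ (↭-sym (labels-suc R Γ Δ f)) (here refl)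

∈-labels-target : ∀ {S x y} → (x , y) ∈ rel S → y ∈ labels S
∈-labels-target {⟨ _ ∷ R , Γ ⇒ Δ ⟩} (here refl) = there (here refl)
∈-labels-target {⟨ _ ∷ R , Γ ⇒ Δ ⟩} (there e) =
  there (there (∈-labels-target {⟨ R , Γ ⇒ Δ ⟩} e))

labels-ant-absorb : ∀ R Γ Δ (f : LFm) → proj₁ f ∈ labels ⟨ R , Γ ⇒ Δ ⟩ →
                    labels ⟨ R , f ∷ Γ ⇒ Δ ⟩ ∼[ set ] labels ⟨ R , Γ ⇒ Δ ⟩
labels-ant-absorb R Γ Δ f w∈ = SetEq.trans (↭⇒∼set (labels-ant R Γ Δ f)) (∷-absorb w∈)

labels-suc-absorb : ∀ R Γ Δ (f : LFm) → proj₁ f ∈ labels ⟨ R , Γ ⇒ Δ ⟩ →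
                    labels ⟨ R , Γ ⇒ f ∷ Δ ⟩ ∼[ set ] labels ⟨ R , Γ ⇒ Δ ⟩
labels-suc-absorb R Γ Δ f w∈ = SetEq.trans (↭⇒∼set (labels-suc R Γ Δ f)) (∷-absorb w∈)

∷-absorb-↭ : ∀ {A : Set} {x : A} {xs ys} → xs ↭ x ∷ ys → x ∷ xs ∼[ set ] x ∷ ys
∷-absorb-↭ xs↭x∷ys = SetEq.trans (∷-cong refl (↭⇒∼set xs↭x∷ys)) (∷-absorb (here refl))

fresh-labels : ∀ R Γ Δ w v (C : Fm) →
               w ∷ v ∷ labels ⟨ R , Γ ⇒ Δ ⟩ ∼[ set ] v ∷ labels ⟨ R , Γ ⇒ (w , C) ∷ Δ ⟩
fresh-labels R Γ Δ w v C =
  ↭⇒∼set (↭-trans (↭-swap w v ↭-refl) (↭-prep v (↭-sym (labels-suc R Γ Δ (w , C)))))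

-- edges lists the atoms in the order the leaves were attached; rel S may list them in any
-- order and with repetitions.
record SpanningTree (r : Label) (S : Seq) : Set where
  field
    edges : List RelAtom
    tree  : Tree r edges
    rel≈  : rel S ∼[ set ] edges
    spans : All (IsVertex r edges) (labels S)
    root∈ : r ∈ labels S

SpanningTree⇒rooted : ∀ {r S} → SpanningTree r S → Treelike S × IsRoot S r
SpanningTree⇒rooted {r} {S} st = (r , isRoot , unique) , isRoot
  where
  open SpanningTree st

  in-tree : ∀ {a b vs} → Walk S a b vs → Walk (graph edges) a b vs
  in-tree = Walk-mono (Equivalence.to rel≈)

  isRoot : IsRoot S r
  isRoot = root∈ , λ v v∈ _ →
    let vs , walk , distinct = Tree-path tree (All.lookup spans v∈)
    in vs , (Walk-mono (Equivalence.from rel≈) walk , distinct) ,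
       λ _ (walk′ , _) → Tree-walk-unique tree (in-tree walk′) walk

  unique : ∀ r′ → IsRoot S r′ → r′ ≡ r
  unique r′ (_ , paths) with r′ ≟ r
  ... | yes r′≡r = r′≡r
  ... | no r′≢r =
    let _ , (walk , _) , _ = paths r root∈ (r′≢r ∘ sym)
    in Walk-into-root tree (in-tree walk)

SpanningTree-resp : ∀ {r S T} → rel S ∼[ set ] rel T → labels S ∼[ set ] labels T →
                    SpanningTree r T → SpanningTree r S
SpanningTree-resp rel∼ labels∼ st = record
  { edges = edges
  ; tree  = tree
  ; rel≈  = SetEq.trans rel∼ rel≈
  ; spans = All.tabulate (All.lookup spans ∘ Equivalence.to labels∼)
  ; root∈ = Equivalence.from labels∼ root∈
  }
  where open SpanningTree st

SpanningTree-≈ₛ : ∀ {r S T} → S ≈ₛ T → SpanningTree r S → SpanningTree r T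
SpanningTree-≈ₛ S≈T =
  SpanningTree-resp (↭⇒∼set (↭-sym (_≈ₛ_.rel≈ S≈T))) (SetEq.sym (labels-resp-≈ₛ S≈T))

SpanningTree-fresh : ∀ {r S T w v} → w ∈ labels T → v ∉ labels T →
                     rel S ∼[ set ] (w , v) ∷ rel T → labels S ∼[ set ] v ∷ labels T →
                     SpanningTree r T → SpanningTree r S
SpanningTree-fresh {r} {T = T} {w} {v} w∈ v∉ rel∼ labels∼ st = record
  { edges = (w , v) ∷ edges
  ; tree  = grow tree (All.lookup spans w∈) v-new
  ; rel≈  = SetEq.trans rel∼ (∷-cong refl rel≈)
  ; spans = All.tabulate (new-vertices ∘ Equivalence.to labels∼)
  ; root∈ = Equivalence.from labels∼ (there root∈)
  }
  where
  open SpanningTree st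

  v-new : ¬ IsVertex r edges v
  v-new (inj₁ refl) = v∉ root∈
  v-new (inj₂ (_ , e)) = v∉ (∈-labels-target {T} (Equivalence.from rel≈ e))

  new-vertices : ∀ {x} → x ∈ v ∷ labels T → IsVertex r ((w , v) ∷ edges) x
  new-vertices (here refl) = inj₂ (w , here refl)
  new-vertices (there x∈) = IsVertex-there (All.lookup spans x∈)

module _ {r w : Label} {R : List RelAtom} {Γ Δ : List LFm} where

  same-ant : ∀ {A B} → SpanningTree r ⟨ R , (w , A) ∷ Γ ⇒ Δ ⟩ →
             SpanningTree r ⟨ R , (w , B) ∷ Γ ⇒ Δ ⟩
  same-ant = SpanningTree-resp SetEq.refl SetEq.refl

  same-suc : ∀ {A B} → SpanningTree r ⟨ R , Γ ⇒ (w , A) ∷ Δ ⟩ →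
             SpanningTree r ⟨ R , Γ ⇒ (w , B) ∷ Δ ⟩
  same-suc = SpanningTree-resp SetEq.refl SetEq.refl

  split-ant : ∀ {A B C} → SpanningTree r ⟨ R , (w , A) ∷ Γ ⇒ Δ ⟩ →
              SpanningTree r ⟨ R , (w , B) ∷ (w , C) ∷ Γ ⇒ Δ ⟩
  split-ant {B = B} {C} = SpanningTree-resp SetEq.refl
    (labels-ant-absorb R ((w , C) ∷ Γ) Δ (w , B) (∈-labels-ant R Γ Δ (w , C)))

  split-suc : ∀ {A B C} → SpanningTree r ⟨ R , Γ ⇒ (w , A) ∷ Δ ⟩ →
              SpanningTree r ⟨ R , Γ ⇒ (w , B) ∷ (w , C) ∷ Δ ⟩
  split-suc {B = B} {C} = SpanningTree-resp SetEq.refl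
    (labels-suc-absorb R Γ ((w , C) ∷ Δ) (w , B) (∈-labels-suc R Γ Δ (w , C)))

  ant-to-suc : ∀ {A B} → SpanningTree r ⟨ R , (w , A) ∷ Γ ⇒ Δ ⟩ →
               SpanningTree r ⟨ R , (w , A) ∷ Γ ⇒ (w , B) ∷ Δ ⟩
  ant-to-suc {A} {B} = SpanningTree-resp SetEq.refl
    (labels-suc-absorb R ((w , A) ∷ Γ) Δ (w , B) (∈-labels-ant R Γ Δ (w , A)))

  lift-ant : ∀ {u A} → SpanningTree r ⟨ (w , u) ∷ R , (w , A) ∷ Γ ⇒ Δ ⟩ →
             SpanningTree r ⟨ (w , u) ∷ R , (w , A) ∷ (u , A) ∷ Γ ⇒ Δ ⟩
  lift-ant {u} {A} = SpanningTree-resp SetEq.refl (begin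
    labels ⟨ R′ , (w , A) ∷ (u , A) ∷ Γ ⇒ Δ ⟩
      ≈⟨ labels-ant-absorb R′ ((u , A) ∷ Γ) Δ (w , A) (here refl) ⟩
    labels ⟨ R′ , (u , A) ∷ Γ ⇒ Δ ⟩
      ≈⟨ labels-ant-absorb R′ Γ Δ (u , A) (there (here refl)) ⟩
    labels ⟨ R′ , Γ ⇒ Δ ⟩
      ≈⟨ labels-ant-absorb R′ Γ Δ (w , A) (here refl) ⟨
    labels ⟨ R′ , (w , A) ∷ Γ ⇒ Δ ⟩
      ∎)
    where
    open SetoidReasoning ([ set ]-Equality Label)
    R′ : List RelAtom
    R′ = (w , u) ∷ R

  fresh-ant-suc : ∀ {v A B C} → v ∉ labels ⟨ R , Γ ⇒ (w , C) ∷ Δ ⟩ →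
                  SpanningTree r ⟨ R , Γ ⇒ (w , C) ∷ Δ ⟩ →
                  SpanningTree r ⟨ (w , v) ∷ R , (v , A) ∷ Γ ⇒ (v , B) ∷ Δ ⟩
  fresh-ant-suc {v} {A} {B} {C} v∉ =
    SpanningTree-fresh (∈-labels-suc R Γ Δ (w , C)) v∉ SetEq.refl (begin
      w ∷ v ∷ labels ⟨ R , (v , A) ∷ Γ ⇒ (v , B) ∷ Δ ⟩
        ≈⟨ ∷-cong refl (∷-absorb-↭ (labels-ant R Γ ((v , B) ∷ Δ) (v , A))) ⟩
      w ∷ v ∷ labels ⟨ R , Γ ⇒ (v , B) ∷ Δ ⟩
        ≈⟨ ∷-cong refl (∷-absorb-↭ (labels-suc R Γ Δ (v , B))) ⟩
      w ∷ v ∷ labels ⟨ R , Γ ⇒ Δ ⟩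
        ≈⟨ fresh-labels R Γ Δ w v C ⟩
      v ∷ labels ⟨ R , Γ ⇒ (w , C) ∷ Δ ⟩
        ∎)
    where open SetoidReasoning ([ set ]-Equality Label)

  fresh-ant : ∀ {v A C} → v ∉ labels ⟨ R , Γ ⇒ (w , C) ∷ Δ ⟩ →
              SpanningTree r ⟨ R , Γ ⇒ (w , C) ∷ Δ ⟩ →
              SpanningTree r ⟨ (w , v) ∷ R , (v , A) ∷ Γ ⇒ Δ ⟩
  fresh-ant {v} {A} {C} v∉ = SpanningTree-fresh (∈-labels-suc R Γ Δ (w , C)) v∉ SetEq.refl
    (SetEq.trans (∷-cong refl (∷-absorb-↭ (labels-ant R Γ Δ (v , A)))) (fresh-labels R Γ Δ w v C))

rooted-everywhere : ∀ {r S} (d : Deriv S) → SpanningTree r S →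
                    Everywhere (λ T → Treelike T × IsRoot T r) d
rooted-everywhere (∧l S≈ d) st =
  SpanningTree⇒rooted st , rooted-everywhere d (split-ant (SpanningTree-≈ₛ S≈ st))
rooted-everywhere (∧r S≈ d e) st =
  SpanningTree⇒rooted st , rooted-everywhere d (same-suc (SpanningTree-≈ₛ S≈ st))
                         , rooted-everywhere e (same-suc (SpanningTree-≈ₛ S≈ st))
rooted-everywhere (∨l S≈ d e) st =
  SpanningTree⇒rooted st , rooted-everywhere d (same-ant (SpanningTree-≈ₛ S≈ st))
                         , rooted-everywhere e (same-ant (SpanningTree-≈ₛ S≈ st))
rooted-everywhere (∨r S≈ d) st =
  SpanningTree⇒rooted st , rooted-everywhere d (split-suc (SpanningTree-≈ₛ S≈ st))
rooted-everywhere (⊃r S≈ v∉ d) st =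
  SpanningTree⇒rooted st , rooted-everywhere d (fresh-ant-suc v∉ (SpanningTree-≈ₛ S≈ st))
rooted-everywhere (id* _) st =
  SpanningTree⇒rooted st
rooted-everywhere (¬r S≈ v∉ d) st =
  SpanningTree⇒rooted st , rooted-everywhere d (fresh-ant v∉ (SpanningTree-≈ₛ S≈ st))
rooted-everywhere (¬l S≈ d) st =
  SpanningTree⇒rooted st , rooted-everywhere d (ant-to-suc (SpanningTree-≈ₛ S≈ st))
rooted-everywhere (⊃*l S≈ d e) st =
  SpanningTree⇒rooted st , rooted-everywhere d (ant-to-suc (SpanningTree-≈ₛ S≈ st))
                         , rooted-everywhere e (split-ant (SpanningTree-≈ₛ S≈ st))
rooted-everywhere (lift S≈ d) st =
  SpanningTree⇒rooted st , rooted-everywhere d (lift-ant (SpanningTree-≈ₛ S≈ st))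

theorem4 : ∀ (w : Label) (A : Fm) (d : Deriv ⟨ [] , [] ⇒ (w , A) ∷ [] ⟩) →
    Everywhere (λ S → Treelike S × IsRoot S w) d
theorem4 w A d = rooted-everywhere d (record
  { edges = []
  ; tree  = root
  ; rel≈  = SetEq.refl
  ; spans = inj₁ refl ∷ []
  ; root∈ = here refl
  })
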